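{- Let $g$ be an oriented two-graph on a finite set $V$ and let $C$ be its associated switching class of tournaments on $V$. Then $g$ is special if and only if for every $T\in C$ there is at most one vertex $v\in V$ such that $T^+-v$ is isomorphic to a tournament in $C$.
   Context: For a tournament $T$, $e_T(x,y)=1$ if $(x,y)$ is an edge and $-1$ otherwise, and $g_T(x,y,z)=e_T(x,y)e_T(y,z)e_T(z,x)$. An oriented two-graph on $V$ is an alternating $\{\pm1\}$-valued function on ordered triples of distinct elements with $g(x,y,z)g(y,x,w)g(z,y,w)g(x,z,w)=1$ for distinct $x,y,z,w$. For $X\subseteq V$, $T^X$ reverses all edges between $X$ and $V\setminus X$; switching classes are the equivalence classes of the relation $T_2=T_1^X$ for some $X$. The switching class associated to $g$ is $C=\{T: g_T=g\}$. $T^+$ is the tournament on $V\cup\{\infty\}$ ($\infty$ a new vertex) restricting to $T$ on $V$ with $(x,\infty)$ an edge for all $x\in V$; $T^+-v$ is obtained by deleting $v$. An oriented two-graph $g$ on $r$ vertices is special if for every oriented two-graph $h$ on a set $W$ with $|W|=r+1$, the number of subsets $A\subset W$ with $h|_A\cong g$ (restriction, isomorphism via a bijection preserving the function) is at most $2$. -}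

module Defs where

open import Data.Nat using (ℕ; suc)
open import Data.Fin using (Fin; zero; suc; punchIn)
open import Data.Fin.Properties using (suc-injective; punchIn-injective)
open import Data.Fin.Subset using (Subset; _∈_)
open import Data.Bool using (Bool; true; false; not)
open import Data.Sign using (Sign; opposite; _*_) renaming (+ to pos; - to neg)
open import Data.Empty using (⊥)
open import Data.Product using (Σ; ∃; _×_; _,_)
open import Function using (_⤖_; _⇔_)
open import Function.Bundles using (Bijection)
open import Function.Definitions using (Injective)
open import Relation.Binary.PropositionalEquality using (_≡_; _≢_; refl; cong)

-- Vertex sets are taken to be Fin n (any finite set is in bijection with one).

Distinct3 : {n : ℕ} → Fin n → Fin n → Fin n → Set
Distinct3 x y z = x ≢ y × y ≢ z × x ≢ z

Distinct4 : {n : ℕ} → Fin n → Fin n → Fin n → Fin n → Set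
Distinct4 x y z w = Distinct3 x y z × x ≢ w × y ≢ w × z ≢ w

-- An oriented two-graph: a {±1}-valued function on ordered triples of
-- distinct elements (values on non-distinct triples are irrelevant and
-- never inspected), alternating, and satisfying the 4-point condition.
record OrientedTwoGraph (n : ℕ) : Set where
  field
    fn : Fin n → Fin n → Fin n → Sign
    -- alternating: swapping either adjacent pair negates (these transpositions generate S₃)
    alt₁ : ∀ x y z → Distinct3 x y z → fn y x z ≡ opposite (fn x y z)
    alt₂ : ∀ x y z → Distinct3 x y z → fn x z y ≡ opposite (fn x y z)
    cocycle : ∀ x y z w → Distinct4 x y z w →
      fn x y z * fn y x w * fn z y w * fn x z w ≡ pos
open OrientedTwoGraph public

record Tournament (n : ℕ) : Set where
  field
    edge : Fin n → Fin n → Bool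
    irrefl : ∀ x → edge x x ≡ false
    tourn : ∀ x y → x ≢ y → edge y x ≡ not (edge x y)
open Tournament public

eT : {n : ℕ} → Tournament n → Fin n → Fin n → Sign
eT T x y with edge T x y
... | true = pos
... | false = neg

gT : {n : ℕ} → Tournament n → Fin n → Fin n → Fin n → Sign
gT T x y z = eT T x y * eT T y z * eT T z x

-- T ∈ C, the switching class associated to g: g_T = g (on distinct triples).
InClass : {n : ℕ} → OrientedTwoGraph n → Tournament n → Set
InClass g T = ∀ x y z → Distinct3 x y z → gT T x y z ≡ fn g x y z

-- T⁺ on Fin (suc n); the new vertex ∞ is zero, v ∈ V is suc v.
plusEdge : {n : ℕ} → Tournament n → Fin (suc n) → Fin (suc n) → Bool
plusEdge T zero y = false
plusEdge T (suc x) zero = true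
plusEdge T (suc x) (suc y) = edge T x y

plus : {n : ℕ} → Tournament n → Tournament (suc n)
plus T = record { edge = plusEdge T ; irrefl = ir ; tourn = tr }
  where
  ir : ∀ x → plusEdge T x x ≡ false
  ir zero = refl
  ir (suc x) = irrefl T x
  tr : ∀ x y → x ≢ y → plusEdge T y x ≡ not (plusEdge T x y)
  tr zero zero ne with () ← ne refl
  tr zero (suc y) ne = refl
  tr (suc x) zero ne = refl
  tr (suc x) (suc y) ne = tourn T x y (λ e → ne (cong suc e))

delete : {n : ℕ} → Tournament (suc n) → Fin (suc n) → Tournament n
delete T w = record
  { edge = λ x y → edge T (punchIn w x) (punchIn w y)
  ; irrefl = λ x → irrefl T (punchIn w x)
  ; tourn = λ x y ne → tourn T (punchIn w x) (punchIn w y)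
                          (λ e → ne (punchIn-injective w x y e))
  }

plusMinus : {n : ℕ} → Tournament n → Fin n → Tournament n
plusMinus T v = delete (plus T) (suc v)

_≅T_ : {n : ℕ} → Tournament n → Tournament n → Set
_≅T_ {n} T T' = Σ (Fin n ⤖ Fin n) λ σ →
  ∀ x y → edge T' (Bijection.to σ x) (Bijection.to σ y) ≡ edge T x y

RestrictionIso : {m r : ℕ} → OrientedTwoGraph m → Subset m → OrientedTwoGraph r → Set
RestrictionIso {m} {r} h A g = Σ (Fin r → Fin m) λ f →
  Injective _≡_ _≡_ f ×
  (∀ y → (y ∈ A) ⇔ (∃ λ x → f x ≡ y)) ×
  (∀ x y z → Distinct3 x y z → fn h (f x) (f y) (f z) ≡ fn g x y z)

-- g (on r vertices) is special: for every oriented two-graph h on r+1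
-- vertices, at most 2 subsets A have h|_A ≅ g (i.e. no three distinct ones).
Special : {r : ℕ} → OrientedTwoGraph r → Set
Special {r} g = (h : OrientedTwoGraph (suc r)) (A₁ A₂ A₃ : Subset (suc r)) →
  A₁ ≢ A₂ → A₁ ≢ A₃ → A₂ ≢ A₃ →
  RestrictionIso h A₁ g → RestrictionIso h A₂ g → RestrictionIso h A₃ g →
  ⊥

-- If T ∈ C and T⁺ − v, T⁺ − w are isomorphic to tournaments in C for v ≠ w, then
-- the oriented two-graph of T⁺ restricts to a copy of g on the three distinct sets
-- V, (V ∪ {∞}) − v and (V ∪ {∞}) − w, so g is not special.
--
-- Conversely, a copy of g inside an oriented two-graph h on r + 1 points occupies
-- the complement of a single point. Given copies at three points q₁, q₂, q₃,
-- realise h by a tournament S in which q₃ is a sink; then S = T⁺ with ∞ = q₃ for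
-- the tournament T ∈ C read off from the copy at q₃, and the copies at q₁ and q₂
-- make T⁺ − v₁ and T⁺ − v₂ isomorphic to tournaments in C, where vᵢ is the vertex
-- of T sitting at qᵢ. Uniqueness forces v₁ = v₂, hence q₁ = q₂.

module Submission where

open import Defs
open import Data.Nat using (ℕ; zero; suc)
open import Data.Nat.Properties using (1+n≰n)
open import Data.Bool using (Bool; true; false; not)
open import Data.Empty using (⊥-elim)
open import Data.Fin using (Fin; zero; suc; punchIn; punchOut; _≟_)
open import Data.Fin.Properties
  using (0≢1+n; suc-injective; punchIn-injective; punchOut-injective; punchIn-punchOut; punchInᵢ≢i; any?; ¬∀⟶∃¬; injective⇒≤)
open import Data.Fin.Permutation
  using (Permutation′; _⟨$⟩ʳ_; _⟨$⟩ˡ_; inverseʳ; permutation; flip; _∘ₚ_; id; insert; remove; punchIn-permute)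
open import Data.Fin.Subset using (_∈_; ∁; ⁅_⁆)
open import Data.Fin.Subset.Properties using (x∈∁p⇒x∉p; x∉p⇒x∈∁p; x∈⁅x⁆; x∈⁅y⁆⇒x≡y; ⊆-antisym)
open import Data.Product using (Σ; ∃; _×_; _,_; proj₁; proj₂; map₂)
open import Data.Sign using (Sign; opposite; _*_) renaming (+ to pos; - to neg)
open import Data.Sign.Properties
  using (*-commutativeMonoid; *-identityʳ; *-cancelˡ-≡; s*s≡+; s*opposite[s]≡-; opposite-involutive)
open import Algebra.Solver.CommutativeMonoid *-commutativeMonoid using (solve; _⊜_; _⊕_)
open import Function using (_∘_; _⇔_; mk⇔; Equivalence)
open import Function.Bundles using (Bijection)
open import Function.Definitions using (Injective)
open import Function.Properties.Bijection using (⤖⇒↔)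
open import Function.Properties.Inverse using (↔⇒⤖)
open import Function.Properties.Equivalence using () renaming (trans to ⇔-trans)
open import Relation.Binary.PropositionalEquality
open import Relation.Nullary using (Dec; yes; no; ¬_)
open import Relation.Nullary.Decidable using (decidable-stable)

*-rotate : ∀ a b c → a * b * c ≡ b * c * a
*-rotate = solve 3 (λ a b c → (a ⊕ b) ⊕ c ⊜ (b ⊕ c) ⊕ a) refl

opposite-reverse : ∀ a b c → opposite c * opposite b * opposite a ≡ opposite (a * b * c)
opposite-reverse pos pos pos = refl
opposite-reverse pos pos neg = refl
opposite-reverse pos neg pos = refl
opposite-reverse pos neg neg = refl
opposite-reverse neg pos pos = refl
opposite-reverse neg pos neg = refl
opposite-reverse neg neg pos = refl
opposite-reverse neg neg neg = refl

isPositive : Sign → Bool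
isPositive pos = true
isPositive neg = false

isPositive-opposite : ∀ s → isPositive (opposite s) ≡ not (isPositive s)
isPositive-opposite pos = refl
isPositive-opposite neg = refl

fn-rotate : ∀ {n} (g : OrientedTwoGraph n) {x y z} → Distinct3 x y z → fn g y z x ≡ fn g x y z
fn-rotate g {x} {y} {z} d@(x≢y , y≢z , x≢z) = begin
  fn g y z x                       ≡⟨ alt₂ g y x z (≢-sym x≢y , x≢z , y≢z) ⟩
  opposite (fn g y x z)            ≡⟨ cong opposite (alt₁ g x y z d) ⟩
  opposite (opposite (fn g x y z)) ≡⟨ opposite-involutive _ ⟩
  fn g x y z                       ∎
  where open ≡-Reasoning

-- The oriented two-graph of a tournament

SignAntisymmetric : ∀ {n} → (Fin n → Fin n → Sign) → Set
SignAntisymmetric e = ∀ {x y} → x ≢ y → e y x ≡ opposite (e x y)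

eT-antisym : ∀ {n} (T : Tournament n) → SignAntisymmetric (eT T)
eT-antisym T {x} {y} x≢y with edge T x y | edge T y x | tourn T x y x≢y
... | true  | .false | refl = refl
... | false | .true  | refl = refl

eT-cong : ∀ {m n} (T : Tournament m) (T′ : Tournament n) {a b x y} →
          edge T a b ≡ edge T′ x y → eT T a b ≡ eT T′ x y
eT-cong T T′ {a} {b} {x} {y} e with edge T a b | edge T′ x y
... | true  | true  = refl
... | false | false = refl

module _ {n : ℕ} (T : Tournament n) where

  private
    e : Fin n → Fin n → Sign
    e = eT T

  eT-pair : ∀ {x y} → x ≢ y → e x y * e y x ≡ neg
  eT-pair {x} {y} x≢y = trans (cong (e x y *_) (eT-antisym T x≢y)) (s*opposite[s]≡- (e x y))

  gT-rotate : ∀ x y z → gT T x y z ≡ gT T y z x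
  gT-rotate x y z = *-rotate (e x y) (e y z) (e z x)

  gT-alt₂ : ∀ x y z → Distinct3 x y z → gT T x z y ≡ opposite (gT T x y z)
  gT-alt₂ x y z (x≢y , y≢z , x≢z) = begin
    e x z * e z y * e y x
      ≡⟨ cong₂ _*_ (cong₂ _*_ (eT-antisym T (≢-sym x≢z)) (eT-antisym T y≢z)) (eT-antisym T x≢y) ⟩
    opposite (e z x) * opposite (e y z) * opposite (e x y)
      ≡⟨ opposite-reverse (e x y) (e y z) (e z x) ⟩
    opposite (gT T x y z) ∎
    where open ≡-Reasoning

  gT-alt₁ : ∀ x y z → Distinct3 x y z → gT T y x z ≡ opposite (gT T x y z)
  gT-alt₁ x y z d = trans (gT-rotate y x z) (gT-alt₂ x y z d)

  -- Each of the six edges of {x, y, z, w} is traversed once in each direction.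
  gT-cocycle : ∀ x y z w → Distinct4 x y z w →
               gT T x y z * gT T y x w * gT T z y w * gT T x z w ≡ pos
  gT-cocycle x y z w ((x≢y , y≢z , x≢z) , x≢w , y≢w , z≢w) = begin
    gT T x y z * gT T y x w * gT T z y w * gT T x z w
      ≡⟨ regroup (e x y) (e y x) (e y z) (e z y) (e z x) (e x z) (e x w) (e w x) (e y w) (e w y) (e z w) (e w z) ⟩
    e x y * e y x * (e y z * e z y) * (e z x * e x z) * (e x w * e w x) * (e y w * e w y) * (e z w * e w z)
      ≡⟨ cong₂ _*_ (cong₂ _*_ (cong₂ _*_ (cong₂ _*_ (cong₂ _*_
           (eT-pair x≢y) (eT-pair y≢z)) (eT-pair (≢-sym x≢z))) (eT-pair x≢w)) (eT-pair y≢w)) (eT-pair z≢w) ⟩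
    pos ∎
    where
    open ≡-Reasoning
    regroup : ∀ a a′ b b′ c c′ d d′ k k′ l l′ →
      (a * b * c) * (a′ * d * k′) * (b′ * k * l′) * (c′ * l * d′)
        ≡ (a * a′) * (b * b′) * (c * c′) * (d * d′) * (k * k′) * (l * l′)
    regroup = solve 12 (λ a a′ b b′ c c′ d d′ k k′ l l′ →
      ((((a ⊕ b) ⊕ c) ⊕ ((a′ ⊕ d) ⊕ k′)) ⊕ ((b′ ⊕ k) ⊕ l′)) ⊕ ((c′ ⊕ l) ⊕ d′)
        ⊜ (((((a ⊕ a′) ⊕ (b ⊕ b′)) ⊕ (c ⊕ c′)) ⊕ (d ⊕ d′)) ⊕ (k ⊕ k′)) ⊕ (l ⊕ l′)) refl

twoGraph : ∀ {n} → Tournament n → OrientedTwoGraph n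
twoGraph T = record { fn = gT T ; alt₁ = gT-alt₁ T ; alt₂ = gT-alt₂ T ; cocycle = gT-cocycle T }

-- Embeddings of tournaments

record Embedding {m n} (T : Tournament m) (S : Tournament n) (f : Fin m → Fin n) : Set where
  constructor mkEmbedding
  field edge-preserved : ∀ x y → edge S (f x) (f y) ≡ edge T x y
open Embedding

module _ {m n} {T : Tournament m} {S : Tournament n} {f : Fin m → Fin n} where

  gT-embedding : Embedding T S f → ∀ x y z → gT S (f x) (f y) (f z) ≡ gT T x y z
  gT-embedding emb x y z = cong₂ _*_ (cong₂ _*_ (eT-S-T x y) (eT-S-T y z)) (eT-S-T z x)
    where
    eT-S-T : ∀ a b → eT S (f a) (f b) ≡ eT T a b
    eT-S-T a b = eT-cong S T (edge-preserved emb a b)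

  embedding-∘ : ∀ {k} {U : Tournament k} {h : Fin k → Fin m} →
                Embedding T S f → Embedding U T h → Embedding U S (f ∘ h)
  edge-preserved (embedding-∘ f-emb h-emb) x y = trans (edge-preserved f-emb _ _) (edge-preserved h-emb x y)

embedding-inverse : ∀ {n} {T S : Tournament n} (π : Permutation′ n) →
                    Embedding T S (π ⟨$⟩ʳ_) → Embedding S T (π ⟨$⟩ˡ_)
edge-preserved (embedding-inverse {S = S} π emb) x y =
  trans (sym (edge-preserved emb _ _)) (cong₂ (edge S) (inverseʳ π) (inverseʳ π))

embedding-delete : ∀ {n} {T S : Tournament (suc n)} (π : Permutation′ (suc n)) {w w′} →
                   Embedding T S (π ⟨$⟩ʳ_) → π ⟨$⟩ʳ w ≡ w′ →
                   Embedding (delete T w) (delete S w′) (remove w π ⟨$⟩ʳ_)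
edge-preserved (embedding-delete {S = S} π {w} emb refl) x y =
  trans (sym (cong₂ (edge S) (punchIn-permute π w x) (punchIn-permute π w y))) (edge-preserved emb _ _)

delete-embedding : ∀ {n} (S : Tournament (suc n)) (q : Fin (suc n)) → Embedding (delete S q) S (punchIn q)
edge-preserved (delete-embedding S q) x y = refl

≅T-via : ∀ {n} {T T′ : Tournament n} (π : Permutation′ n) → Embedding T T′ (π ⟨$⟩ʳ_) → T ≅T T′
≅T-via π emb = ↔⇒⤖ π , edge-preserved emb

delete-plus-zero : ∀ {n} (T : Tournament n) → delete (plus T) zero ≅T T
delete-plus-zero T = ≅T-via id (mkEmbedding {T = delete (plus T) zero} {S = T} λ _ _ → refl)

pullback : ∀ {m n} (S : Tournament n) (f : Fin m → Fin n) → Injective _≡_ _≡_ f → Tournament m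
pullback S f inj = record
  { edge = λ x y → edge S (f x) (f y)
  ; irrefl = λ x → irrefl S (f x)
  ; tourn = λ x y x≢y → tourn S (f x) (f y) (x≢y ∘ inj)
  }

pullback-embedding : ∀ {m n} (S : Tournament n) (f : Fin m → Fin n) (inj : Injective _≡_ _≡_ f) →
                     Embedding (pullback S f inj) S f
edge-preserved (pullback-embedding S f inj) x y = refl

-- Realising an oriented two-graph with a prescribed sink

module _ {n : ℕ} (e : Fin n → Fin n → Sign) where

  signEdge : Fin n → Fin n → Bool
  signEdge x y with x ≟ y
  ... | yes _ = false
  ... | no _  = isPositive (e x y)

  signEdge-irrefl : ∀ x → signEdge x x ≡ false
  signEdge-irrefl x with x ≟ x
  ... | yes _   = refl
  ... | no x≢x = ⊥-elim (x≢x refl)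

  signEdge-≢ : ∀ {x y} → x ≢ y → signEdge x y ≡ isPositive (e x y)
  signEdge-≢ {x} {y} x≢y with x ≟ y
  ... | yes x≡y = ⊥-elim (x≢y x≡y)
  ... | no _    = refl

  signTournament : SignAntisymmetric e → Tournament n
  signTournament anti = record
    { edge = signEdge
    ; irrefl = signEdge-irrefl
    ; tourn = λ x y x≢y → begin
        signEdge y x                  ≡⟨ signEdge-≢ (≢-sym x≢y) ⟩
        isPositive (e y x)            ≡⟨ cong isPositive (anti x≢y) ⟩
        isPositive (opposite (e x y)) ≡⟨ isPositive-opposite (e x y) ⟩
        not (isPositive (e x y))      ≡⟨ cong not (signEdge-≢ x≢y) ⟨
        not (signEdge x y)            ∎
    }
    where open ≡-Reasoning

  eT-signTournament : (anti : SignAntisymmetric e) → ∀ {x y} → x ≢ y → eT (signTournament anti) x y ≡ e x y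
  eT-signTournament anti {x} {y} x≢y with signEdge x y | signEdge-≢ x≢y
  ... | _ | refl with e x y
  ...   | pos = refl
  ...   | neg = refl

IsSink : ∀ {n} → Tournament n → Fin n → Set
IsSink S q = ∀ a → a ≢ q → edge S a q ≡ true

module SinkRealisation {n : ℕ} (h : OrientedTwoGraph n) (q : Fin n) where

  -- Once q is a sink, g_S(a, b, q) = h(a, b, q) forces e_S(a, b) = −h(q, a, b).
  sinkSign : Fin n → Fin n → Sign
  sinkSign a b with a ≟ q | b ≟ q
  ... | yes _ | _     = neg
  ... | no _  | yes _ = pos
  ... | no _  | no _  = opposite (fn h q a b)

  sinkSign-from : ∀ {a b} → a ≡ q → sinkSign a b ≡ neg
  sinkSign-from {a} a≡q with a ≟ q
  ... | yes _   = refl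
  ... | no a≢q = ⊥-elim (a≢q a≡q)

  sinkSign-to : ∀ {a b} → a ≢ q → b ≡ q → sinkSign a b ≡ pos
  sinkSign-to {a} {b} a≢q b≡q with a ≟ q | b ≟ q
  ... | yes a≡q | _      = ⊥-elim (a≢q a≡q)
  ... | no _    | yes _  = refl
  ... | no _    | no b≢q = ⊥-elim (b≢q b≡q)

  sinkSign-away : ∀ {a b} → a ≢ q → b ≢ q → sinkSign a b ≡ opposite (fn h q a b)
  sinkSign-away {a} {b} a≢q b≢q with a ≟ q | b ≟ q
  ... | yes a≡q | _       = ⊥-elim (a≢q a≡q)
  ... | no _    | yes b≡q = ⊥-elim (b≢q b≡q)
  ... | no _    | no _    = refl

  sinkSign-antisym : SignAntisymmetric sinkSign
  sinkSign-antisym {x} {y} x≢y = by-cases (x ≟ q) (y ≟ q)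
    where
    by-cases : Dec (x ≡ q) → Dec (y ≡ q) → sinkSign y x ≡ opposite (sinkSign x y)
    by-cases (yes x≡q) (yes y≡q) = ⊥-elim (x≢y (trans x≡q (sym y≡q)))
    by-cases (yes x≡q) (no y≢q)  =
      trans (sinkSign-to y≢q x≡q) (cong opposite (sym (sinkSign-from x≡q)))
    by-cases (no x≢q)  (yes y≡q) =
      trans (sinkSign-from y≡q) (cong opposite (sym (sinkSign-to x≢q y≡q)))
    by-cases (no x≢q)  (no y≢q)  =
      trans (sinkSign-away y≢q x≢q)
        (cong opposite (trans (alt₂ h q x y (≢-sym x≢q , x≢y , ≢-sym y≢q)) (sym (sinkSign-away x≢q y≢q))))

  sinkTriangle : Fin n → Fin n → Fin n → Sign
  sinkTriangle x y z = sinkSign x y * sinkSign y z * sinkSign z x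

  sinkTriangle-apex : ∀ {x y z} → x ≡ q → y ≢ q → z ≢ q → sinkTriangle x y z ≡ fn h x y z
  sinkTriangle-apex {x} {y} {z} refl y≢q z≢q = begin
    sinkSign q y * sinkSign y z * sinkSign z q
      ≡⟨ cong₂ _*_ (cong₂ _*_ (sinkSign-from refl) (sinkSign-away y≢q z≢q)) (sinkSign-to z≢q refl) ⟩
    opposite (opposite (fn h q y z)) * pos
      ≡⟨ trans (*-identityʳ _) (opposite-involutive _) ⟩
    fn h q y z ∎
    where open ≡-Reasoning

  -- The cocycle condition at (x, y, z, q) says exactly that g_S and h agree on {x, y, z}.
  sinkTriangle-away : ∀ {x y z} → Distinct3 x y z → x ≢ q → y ≢ q → z ≢ q → sinkTriangle x y z ≡ fn h x y z
  sinkTriangle-away {x} {y} {z} d@(x≢y , y≢z , x≢z) x≢q y≢q z≢q =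
    *-cancelˡ-≡ (fn h x y z) _ _ (begin
      fn h x y z * (sinkSign x y * sinkSign y z * sinkSign z x)
        ≡⟨ reassociate (fn h x y z) _ _ _ ⟩
      fn h x y z * sinkSign x y * sinkSign y z * sinkSign z x
        ≡⟨ cong₂ _*_ (cong₂ _*_ (cong (fn h x y z *_) (sinkSign≡fn x≢q y≢q x≢y))
                                (sinkSign≡fn y≢q z≢q y≢z)) (sinkSign≡fn z≢q x≢q (≢-sym x≢z)) ⟩
      fn h x y z * fn h y x q * fn h z y q * fn h x z q
        ≡⟨ cocycle h x y z q (d , x≢q , y≢q , z≢q) ⟩
      pos
        ≡⟨ s*s≡+ (fn h x y z) ⟨
      fn h x y z * fn h x y z ∎)
    where
    open ≡-Reasoning
    reassociate : ∀ a b c d → a * (b * c * d) ≡ a * b * c * d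
    reassociate = solve 4 (λ a b c d → a ⊕ ((b ⊕ c) ⊕ d) ⊜ ((a ⊕ b) ⊕ c) ⊕ d) refl
    sinkSign≡fn : ∀ {a b} → a ≢ q → b ≢ q → a ≢ b → sinkSign a b ≡ fn h b a q
    sinkSign≡fn {a} {b} a≢q b≢q a≢b = begin
      sinkSign a b          ≡⟨ sinkSign-away a≢q b≢q ⟩
      opposite (fn h q a b) ≡⟨ alt₂ h q a b (≢-sym a≢q , a≢b , ≢-sym b≢q) ⟨
      fn h q b a            ≡⟨ fn-rotate h (≢-sym b≢q , ≢-sym a≢b , ≢-sym a≢q) ⟨
      fn h b a q            ∎

  sinkTriangle≡fn : ∀ {x y z} → Distinct3 x y z → sinkTriangle x y z ≡ fn h x y z
  sinkTriangle≡fn {x} {y} {z} d@(x≢y , y≢z , x≢z) = by-cases (x ≟ q) (y ≟ q) (z ≟ q)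
    where
    open ≡-Reasoning
    by-cases : Dec (x ≡ q) → Dec (y ≡ q) → Dec (z ≡ q) → sinkTriangle x y z ≡ fn h x y z
    by-cases (yes x≡q) (no y≢q) (no z≢q) = sinkTriangle-apex x≡q y≢q z≢q
    by-cases (no x≢q) (yes y≡q) (no z≢q) = begin
      sinkTriangle x y z ≡⟨ *-rotate (sinkSign x y) _ _ ⟩
      sinkTriangle y z x ≡⟨ sinkTriangle-apex y≡q z≢q x≢q ⟩
      fn h y z x         ≡⟨ fn-rotate h d ⟩
      fn h x y z         ∎
    by-cases (no x≢q) (no y≢q) (yes z≡q) = begin
      sinkTriangle x y z ≡⟨ *-rotate (sinkSign z x) _ _ ⟨
      sinkTriangle z x y ≡⟨ sinkTriangle-apex z≡q x≢q y≢q ⟩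
      fn h z x y         ≡⟨ fn-rotate h (≢-sym x≢z , x≢y , ≢-sym y≢z) ⟨
      fn h x y z         ∎
    by-cases (no x≢q) (no y≢q) (no z≢q) = sinkTriangle-away d x≢q y≢q z≢q
    by-cases (yes x≡q) (yes y≡q) _ = ⊥-elim (x≢y (trans x≡q (sym y≡q)))
    by-cases (yes x≡q) _ (yes z≡q) = ⊥-elim (x≢z (trans x≡q (sym z≡q)))
    by-cases _ (yes y≡q) (yes z≡q) = ⊥-elim (y≢z (trans y≡q (sym z≡q)))

  sinkTournament : Tournament n
  sinkTournament = signTournament sinkSign sinkSign-antisym

  sinkTournament-isSink : IsSink sinkTournament q
  sinkTournament-isSink a a≢q = trans (signEdge-≢ sinkSign a≢q) (cong isPositive (sinkSign-to a≢q refl))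

  sinkTournament-inClass : InClass h sinkTournament
  sinkTournament-inClass x y z d@(x≢y , y≢z , x≢z) =
    trans (cong₂ _*_ (cong₂ _*_ (eT-S x≢y) (eT-S y≢z)) (eT-S (≢-sym x≢z))) (sinkTriangle≡fn d)
    where
    eT-S : ∀ {a b} → a ≢ b → eT sinkTournament a b ≡ sinkSign a b
    eT-S = eT-signTournament sinkSign sinkSign-antisym

module _ {m n : ℕ} {f : Fin m → Fin (suc n)} {q : Fin (suc n)} (f≢q : ∀ x → f x ≢ q) where

  punchOutAll : Fin m → Fin n
  punchOutAll x = punchOut (f≢q x ∘ sym)

  punchOutAll-injective : Injective _≡_ _≡_ f → Injective _≡_ _≡_ punchOutAll
  punchOutAll-injective inj = inj ∘ punchOut-injective (f≢q _ ∘ sym) (f≢q _ ∘ sym)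

  punchIn-punchOutAll : ∀ x → punchIn q (punchOutAll x) ≡ f x
  punchIn-punchOutAll x = punchIn-punchOut (f≢q x ∘ sym)

injective⇒surjective : ∀ {n} (f : Fin n → Fin n) → Injective _≡_ _≡_ f → ∀ y → ∃ λ x → f x ≡ y
injective⇒surjective {suc n} f inj y with any? (λ x → f x ≟ y)
... | yes hit = hit
... | no miss = ⊥-elim (1+n≰n (injective⇒≤ (punchOutAll-injective (λ x fx≡y → miss (x , fx≡y)) inj)))

injective⇒permutation : ∀ {n} (f : Fin n → Fin n) → Injective _≡_ _≡_ f → Permutation′ n
injective⇒permutation f inj = permutation f (proj₁ ∘ surj) (proj₂ ∘ surj) (λ x → inj (proj₂ (surj (f x))))
  where
  surj : ∀ y → ∃ λ x → f x ≡ y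
  surj = injective⇒surjective f inj

injection-misses : ∀ {n} (f : Fin n → Fin (suc n)) → Injective _≡_ _≡_ f → ∃ λ q → ∀ x → f x ≢ q
injection-misses {n} f inj =
  map₂ (λ q∉image x fx≡q → q∉image (x , fx≡q))
       (¬∀⟶∃¬ (suc n) (λ y → ∃ λ x → f x ≡ y) (λ y → any? (λ x → f x ≟ y)) not-surjective)
  where
  not-surjective : ¬ (∀ y → ∃ λ x → f x ≡ y)
  not-surjective surj = 1+n≰n (injective⇒≤ {f = proj₁ ∘ surj}
    (λ {a} {b} eq → trans (sym (proj₂ (surj a))) (trans (cong f eq) (proj₂ (surj b)))))

-- Restrictions to complements of points

record Preserves {m n} (h : OrientedTwoGraph m) (f : Fin n → Fin m) (g : OrientedTwoGraph n) : Set where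
  field fn-preserved : ∀ x y z → Distinct3 x y z → fn h (f x) (f y) (f z) ≡ fn g x y z
open Preserves

∈∁⁅⁆⇔≢ : ∀ {n} {q y : Fin n} → y ∈ ∁ ⁅ q ⁆ ⇔ y ≢ q
∈∁⁅⁆⇔≢ {q = q} = mk⇔ (λ y∈ y≡q → x∈∁p⇒x∉p y∈ (subst (_∈ ⁅ q ⁆) (sym y≡q) (x∈⁅x⁆ q)))
                     (λ y≢q → x∉p⇒x∈∁p (y≢q ∘ x∈⁅y⁆⇒x≡y q))

∁⁅⁆-injective : ∀ {n} {p q : Fin n} → ∁ ⁅ p ⁆ ≡ ∁ ⁅ q ⁆ → p ≡ q
∁⁅⁆-injective {p = p} {q} eq = decidable-stable (p ≟ q) λ p≢q →
  Equivalence.to ∈∁⁅⁆⇔≢ (subst (p ∈_) (sym eq) (Equivalence.from ∈∁⁅⁆⇔≢ p≢q)) refl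

module _ {n : ℕ} (q : Fin (suc n)) (τ : Permutation′ n) where

  punchIn∘τ : Fin n → Fin (suc n)
  punchIn∘τ x = punchIn q (τ ⟨$⟩ʳ x)

  punchIn∘τ-injective : Injective _≡_ _≡_ punchIn∘τ
  punchIn∘τ-injective = Bijection.injective (↔⇒⤖ τ) ∘ punchIn-injective q _ _

  punchIn∘τ-image : ∀ {y} → y ≢ q ⇔ ∃ λ x → punchIn∘τ x ≡ y
  punchIn∘τ-image = mk⇔
    (λ y≢q → τ ⟨$⟩ˡ punchOut (y≢q ∘ sym) ,
             trans (cong (punchIn q) (inverseʳ τ)) (punchIn-punchOut (y≢q ∘ sym)))
    (λ { (x , refl) → punchInᵢ≢i q (τ ⟨$⟩ʳ x) })

  restrictionIso-∁ : ∀ {h : OrientedTwoGraph (suc n)} {g : OrientedTwoGraph n} →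
                     Preserves h punchIn∘τ g → RestrictionIso h (∁ ⁅ q ⁆) g
  restrictionIso-∁ pres =
    punchIn∘τ , punchIn∘τ-injective , (λ y → ⇔-trans ∈∁⁅⁆⇔≢ punchIn∘τ-image) , fn-preserved pres

restrictionIso⇒∁ : ∀ {n} {h : OrientedTwoGraph (suc n)} {A} {g : OrientedTwoGraph n} →
  RestrictionIso h A g →
  Σ (Fin (suc n)) λ q → Σ (Permutation′ n) λ τ → A ≡ ∁ ⁅ q ⁆ × Preserves h (punchIn∘τ q τ) g
restrictionIso⇒∁ {n} {h} {A} {g} (f , inj , image , pres) = q , τ , A≡∁⁅q⁆ , pres′
  where
  q : Fin (suc n)
  q = proj₁ (injection-misses f inj)
  f≢q : ∀ x → f x ≢ q
  f≢q = proj₂ (injection-misses f inj)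
  τ : Permutation′ n
  τ = injective⇒permutation (punchOutAll f≢q) (punchOutAll-injective f≢q inj)
  f≡ : ∀ x → punchIn∘τ q τ x ≡ f x
  f≡ = punchIn-punchOutAll f≢q
  A≡∁⁅q⁆ : A ≡ ∁ ⁅ q ⁆
  A≡∁⁅q⁆ = ⊆-antisym A⊆∁⁅q⁆ ∁⁅q⁆⊆A
    where
    A⊆∁⁅q⁆ : ∀ {y} → y ∈ A → y ∈ ∁ ⁅ q ⁆
    A⊆∁⁅q⁆ y∈A with x , fx≡y ← Equivalence.to (image _) y∈A =
      Equivalence.from ∈∁⁅⁆⇔≢ (f≢q x ∘ trans fx≡y)
    ∁⁅q⁆⊆A : ∀ {y} → y ∈ ∁ ⁅ q ⁆ → y ∈ A
    ∁⁅q⁆⊆A y∈∁ with x , eq ← Equivalence.to (punchIn∘τ-image q τ) (Equivalence.to ∈∁⁅⁆⇔≢ y∈∁) =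
      Equivalence.from (image _) (x , trans (sym (f≡ x)) eq)
  pres′ : Preserves h (punchIn∘τ q τ) g
  fn-preserved pres′ x y z d rewrite f≡ x | f≡ y | f≡ z = pres x y z d

preserves-twoGraph : ∀ {m n} {T : Tournament m} {S : Tournament n} {f : Fin m → Fin n}
                     {g : OrientedTwoGraph m} →
                     Embedding T S f → InClass g T → Preserves (twoGraph S) f g
fn-preserved (preserves-twoGraph emb inT) x y z d = trans (gT-embedding emb x y z) (inT x y z d)

inClass-pullback : ∀ {m n} (S : Tournament n) {f : Fin m → Fin n} (inj : Injective _≡_ _≡_ f)
                   {h : OrientedTwoGraph n} {g : OrientedTwoGraph m} →
                   InClass h S → Preserves h f g → InClass g (pullback S f inj)
inClass-pullback S {f} inj inS pres x y z d@(x≢y , y≢z , x≢z) =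
  trans (sym (gT-embedding (pullback-embedding S f inj) x y z))
        (trans (inS _ _ _ (x≢y ∘ inj , y≢z ∘ inj , x≢z ∘ inj)) (fn-preserved pres x y z d))

restrictionIso-of-≅T : ∀ {n} (S : Tournament (suc n)) (q : Fin (suc n))
                       {g : OrientedTwoGraph n} {T₁ : Tournament n} →
                       InClass g T₁ → delete S q ≅T T₁ → RestrictionIso (twoGraph S) (∁ ⁅ q ⁆) g
restrictionIso-of-≅T {n} S q {g} {T₁} in₁ (σ , emb) =
  restrictionIso-∁ q (flip ρ) {twoGraph S} {g} (preserves-twoGraph T₁↪S in₁)
  where
  ρ : Permutation′ n
  ρ = ⤖⇒↔ σ
  T₁↪S : Embedding T₁ S (punchIn q ∘ (ρ ⟨$⟩ˡ_))
  T₁↪S = embedding-∘ (delete-embedding S q) (embedding-inverse ρ (mkEmbedding {T = delete S q} {S = T₁} emb))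

plus-embedding : ∀ {n} {S : Tournament (suc n)} {T : Tournament n} {q : Fin (suc n)} (τ : Permutation′ n) →
                 IsSink S q → Embedding T S (punchIn∘τ q τ) → Embedding (plus T) S (insert zero q τ ⟨$⟩ʳ_)
edge-preserved (plus-embedding {S = S} {q = q} τ sink emb) = preserved
  where
  preserved : ∀ x y → edge S (insert zero q τ ⟨$⟩ʳ x) (insert zero q τ ⟨$⟩ʳ y) ≡ plusEdge _ x y
  preserved zero    zero    = irrefl S q
  preserved zero    (suc y) = trans (tourn S _ q (punchInᵢ≢i q _)) (cong not (sink _ (punchInᵢ≢i q _)))
  preserved (suc x) zero    = sink _ (punchInᵢ≢i q _)
  preserved (suc x) (suc y) = edge-preserved emb x y

ReturnsToClass : ∀ {n} → OrientedTwoGraph n → Tournament n → Fin n → Set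
ReturnsToClass {n} g T v = Σ (Tournament n) (λ T₁ → InClass g T₁ × (plusMinus T v ≅T T₁))

module SinkRestriction {n : ℕ} {g : OrientedTwoGraph n} {h : OrientedTwoGraph (suc n)}
                       (q : Fin (suc n)) (τ : Permutation′ n) (pres : Preserves h (punchIn∘τ q τ) g) where

  open SinkRealisation h q

  -- The sink realisation of h is T⁺, with ∞ placed at q.
  T : Tournament n
  T = pullback sinkTournament (punchIn∘τ q τ) (punchIn∘τ-injective q τ)

  T-inClass : InClass g T
  T-inClass = inClass-pullback sinkTournament (punchIn∘τ-injective q τ) sinkTournament-inClass pres

  plus-T-embedding : Embedding (plus T) sinkTournament (insert zero q τ ⟨$⟩ʳ_)
  plus-T-embedding = plus-embedding τ sinkTournament-isSink
    (pullback-embedding sinkTournament (punchIn∘τ q τ) (punchIn∘τ-injective q τ))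

  returnsToClass : ∀ p σ → Preserves h (punchIn∘τ p σ) g → p ≢ q →
                   ∃ λ v → punchIn∘τ q τ v ≡ p × ReturnsToClass g T v
  returnsToClass p σ pres′ p≢q with v , qv≡p ← Equivalence.to (punchIn∘τ-image q τ) p≢q =
    v , qv≡p , T′ , inClass-pullback sinkTournament (punchIn∘τ-injective p σ) sinkTournament-inClass pres′ ,
    ≅T-via (remove (suc v) (insert zero q τ) ∘ₚ flip σ) (embedding-∘ S-p↪T′ T⁺-v↪S-p)
    where
    T′ : Tournament n
    T′ = pullback sinkTournament (punchIn∘τ p σ) (punchIn∘τ-injective p σ)
    T⁺-v↪S-p : Embedding (plusMinus T v) (delete sinkTournament p) (remove (suc v) (insert zero q τ) ⟨$⟩ʳ_)
    T⁺-v↪S-p = embedding-delete (insert zero q τ) {w = suc v} plus-T-embedding qv≡p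
    S-p↪T′ : Embedding (delete sinkTournament p) T′ (σ ⟨$⟩ˡ_)
    S-p↪T′ = embedding-inverse σ (mkEmbedding λ _ _ → refl)

special⇒returnsUnique : ∀ {n} {g : OrientedTwoGraph n} → Special g →
  ∀ T → InClass g T → ∀ v w → ReturnsToClass g T v → ReturnsToClass g T w → v ≡ w
special⇒returnsUnique {g = g} sp T inT v w (T₁ , in₁ , ≅₁) (T₂ , in₂ , ≅₂) =
  decidable-stable (v ≟ w) λ v≢w →
    sp (twoGraph (plus T)) (∁ ⁅ zero ⁆) (∁ ⁅ suc v ⁆) (∁ ⁅ suc w ⁆)
       (0≢1+n ∘ ∁⁅⁆-injective) (0≢1+n ∘ ∁⁅⁆-injective) (v≢w ∘ suc-injective ∘ ∁⁅⁆-injective)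
       (restrictionIso-of-≅T (plus T) zero {g} {T} inT (delete-plus-zero T))
       (restrictionIso-of-≅T (plus T) (suc v) {g} {T₁} in₁ ≅₁)
       (restrictionIso-of-≅T (plus T) (suc w) {g} {T₂} in₂ ≅₂)

returnsUnique⇒special : ∀ {n} {g : OrientedTwoGraph n} →
  (∀ T → InClass g T → ∀ v w → ReturnsToClass g T v → ReturnsToClass g T w → v ≡ w) → Special g
returnsUnique⇒special {g = g} unique h A₁ A₂ A₃ A₁≢A₂ A₁≢A₃ A₂≢A₃ r₁ r₂ r₃
  with q₁ , τ₁ , refl , pres₁ ← restrictionIso⇒∁ {h = h} {g = g} r₁
     | q₂ , τ₂ , refl , pres₂ ← restrictionIso⇒∁ {h = h} {g = g} r₂
     | q₃ , τ₃ , refl , pres₃ ← restrictionIso⇒∁ {h = h} {g = g} r₃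
  with v₁ , q₃v₁≡q₁ , ret₁ ← SinkRestriction.returnsToClass q₃ τ₃ pres₃ q₁ τ₁ pres₁ (A₁≢A₃ ∘ cong (∁ ∘ ⁅_⁆))
     | v₂ , q₃v₂≡q₂ , ret₂ ← SinkRestriction.returnsToClass q₃ τ₃ pres₃ q₂ τ₂ pres₂ (A₂≢A₃ ∘ cong (∁ ∘ ⁅_⁆))
  = A₁≢A₂ (cong (∁ ∘ ⁅_⁆) (begin
      q₁                 ≡⟨ q₃v₁≡q₁ ⟨
      punchIn∘τ q₃ τ₃ v₁ ≡⟨ cong (punchIn∘τ q₃ τ₃) (unique T T-inClass v₁ v₂ ret₁ ret₂) ⟩
      punchIn∘τ q₃ τ₃ v₂ ≡⟨ q₃v₂≡q₂ ⟩
      q₂                 ∎))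
  where
  open ≡-Reasoning
  open SinkRestriction q₃ τ₃ pres₃ using (T; T-inClass)

lemma4p9 : (n : ℕ) (g : OrientedTwoGraph n) →
    Special g ⇔
      ((T : Tournament n) → InClass g T → (v w : Fin n) →
        Σ (Tournament n) (λ T₁ → InClass g T₁ × (plusMinus T v ≅T T₁)) →
        Σ (Tournament n) (λ T₂ → InClass g T₂ × (plusMinus T w ≅T T₂)) →
        v ≡ w)
lemma4p9 n g = mk⇔ (special⇒returnsUnique {g = g}) (returnsUnique⇒special {g = g})
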